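{- For all closed terms $P,Q\in\mathcal{SP}_A$: $\mathrm{EqMFEL}\vdash P=Q$ if and only if $\mathit{mfe}(P)=\mathit{mfe}(Q)$. (That is, the logic $\mathrm{MFEL}$, defined by $\mathrm{MFEL}\models P=Q\iff \mathit{mfe}(P)=\mathit{mfe}(Q)$, is axiomatised by $\mathrm{EqMFEL}$.)
   Context: Let $A$ be a countable set of atoms. $\mathcal{SP}_A$ is the set of closed terms generated by $P::=\mathsf T\mid\mathsf F\mid a\mid \neg P\mid P\mathbin{\wedge_\bullet}P\mid P\mathbin{\vee_\bullet}P$ ($a\in A$), with $\mathbin{\wedge_\bullet},\mathbin{\vee_\bullet}$ binary function symbols. $\mathcal T_A$ (evaluation trees): $\mathsf T,\mathsf F\in\mathcal T_A$ and $(X\trianglelefteq a\trianglerighteq Y)\in\mathcal T_A$ for $X,Y\in\mathcal T_A$, $a\in A$ (root $a$, left subtree $X$, right subtree $Y$). Leaf replacement $X[\mathsf T\mapsto Y,\mathsf F\mapsto Z]$: replace every leaf $\mathsf T$ of $X$ by $Y$ and every leaf $\mathsf F$ by $Z$ (simultaneously); omitted replacements are identities. $\mathit{fe}:\mathcal{SP}_A\to\mathcal T_A$: $\mathit{fe}(\mathsf T)=\mathsf T$, $\mathit{fe}(\mathsf F)=\mathsf F$, $\mathit{fe}(a)=\mathsf T\trianglelefteq a\trianglerighteq\mathsf F$, $\mathit{fe}(\neg P)=\mathit{fe}(P)[\mathsf T\mapsto\mathsf F,\mathsf F\mapsto\mathsf T]$, $\mathit{fe}(P\mathbin{\wedge_\bullet}Q)=\mathit{fe}(P)[\mathsf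 T\mapsto\mathit{fe}(Q),\mathsf F\mapsto\mathit{fe}(Q)[\mathsf T\mapsto\mathsf F]]$, $\mathit{fe}(P\mathbin{\vee_\bullet}Q)=\mathit{fe}(P)[\mathsf T\mapsto\mathit{fe}(Q)[\mathsf F\mapsto\mathsf T],\mathsf F\mapsto\mathit{fe}(Q)]$. For $a\in A$ define $L_a,R_a:\mathcal T_A\to\mathcal T_A$ by $L_a(B)=R_a(B)=B$ for $B\in\{\mathsf T,\mathsf F\}$; $L_a(X\trianglelefteq b\trianglerighteq Y)=L_a(X)$ if $b=a$, else $L_a(X)\trianglelefteq b\trianglerighteq L_a(Y)$; $R_a(X\trianglelefteq b\trianglerighteq Y)=R_a(Y)$ if $b=a$, else $R_a(X)\trianglelefteq b\trianglerighteq R_a(Y)$. Define $m(B)=B$ for $B\in\{\mathsf T,\mathsf F\}$ and $m(X\trianglelefteq a\trianglerighteq Y)=m(L_a(X))\trianglelefteq a\trianglerighteq m(R_a(Y))$. Then $\mathit{mfe}(P)=m(\mathit{fe}(P))$. $\mathrm{EqFFEL}$ consists of: $\mathsf F=\neg\mathsf T$; $x\mathbin{\vee_\bullet}y=\neg(\neg x\mathbin{\wedge_\bullet}\neg y)$; $\neg\neg x=x$; $(x\mathbin{\wedge_\bullet}y)\mathbin{\wedge_\bullet}z=x\mathbin{\wedge_\bullet}(y\mathbin{\wedge_\bullet}z)$; $\mathsf T\mathbin{\wedge_\bullet}x=x$; $x\mathbin{\wedge_\bullet}\mathsf T=x$; $x\mathbin{\wedge_\bullet}\mathsf F=\mathsf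 F\mathbin{\wedge_\bullet}x$; $\neg x\mathbin{\wedge_\bullet}\mathsf F=x\mathbin{\wedge_\bullet}\mathsf F$; $(x\mathbin{\wedge_\bullet}\mathsf F)\mathbin{\vee_\bullet}y=(x\mathbin{\vee_\bullet}\mathsf T)\mathbin{\wedge_\bullet}y$; $x\mathbin{\vee_\bullet}(y\mathbin{\wedge_\bullet}\mathsf F)=x\mathbin{\wedge_\bullet}(y\mathbin{\vee_\bullet}\mathsf T)$. $\mathrm{EqMFEL}=\mathrm{EqFFEL}\cup\{(x\mathbin{\vee_\bullet}y)\mathbin{\wedge_\bullet}z=(\neg x\mathbin{\wedge_\bullet}(y\mathbin{\wedge_\bullet}z))\mathbin{\vee_\bullet}(x\mathbin{\wedge_\bullet}z)\}$. $\vdash$ denotes derivability in equational logic. -}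

module Defs where

open import Data.Nat using (ℕ)
open import Relation.Binary.Definitions using (DecidableEquality)
open import Relation.Nullary using (yes; no)
open import Relation.Binary.PropositionalEquality using (_≡_)

record Countable (A : Set) : Set where
  field
    enc : A → ℕ
    enc-inj : ∀ {x y} → enc x ≡ enc y → x ≡ y

module _ (A : Set) where

  data SP : Set where
    T F : SP
    atom : A → SP
    ¬' : SP → SP
    _∧∙_ _∨∙_ : SP → SP → SP

  data Tree : Set where
    Tt Ft : Tree
    node : Tree → A → Tree → Tree

  data Term : Set where
    var : ℕ → Term
    T F : Term
    atom : A → Term
    ¬' : Term → Term
    _∧∙_ _∨∙_ : Term → Term → Term

  ⌜_⌝ : SP → Term
  ⌜ T ⌝ = T
  ⌜ F ⌝ = F
  ⌜ atom a ⌝ = atom a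
  ⌜ ¬' p ⌝ = ¬' ⌜ p ⌝
  ⌜ p ∧∙ q ⌝ = ⌜ p ⌝ ∧∙ ⌜ q ⌝
  ⌜ p ∨∙ q ⌝ = ⌜ p ⌝ ∨∙ ⌜ q ⌝

  _[_] : Term → (ℕ → Term) → Term
  var n [ σ ] = σ n
  T [ σ ] = T
  F [ σ ] = F
  atom a [ σ ] = atom a
  ¬' t [ σ ] = ¬' (t [ σ ])
  (t ∧∙ u) [ σ ] = (t [ σ ]) ∧∙ (u [ σ ])
  (t ∨∙ u) [ σ ] = (t [ σ ]) ∨∙ (u [ σ ])

  -- the axioms of EqMFEL (x = var 0, y = var 1, z = var 2)
  data EqMFEL-axiom : Term → Term → Set where
    ax1  : EqMFEL-axiom F (¬' T)
    ax2  : EqMFEL-axiom (var 0 ∨∙ var 1) (¬' (¬' (var 0) ∧∙ ¬' (var 1)))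
    ax3  : EqMFEL-axiom (¬' (¬' (var 0))) (var 0)
    ax4  : EqMFEL-axiom ((var 0 ∧∙ var 1) ∧∙ var 2) (var 0 ∧∙ (var 1 ∧∙ var 2))
    ax5  : EqMFEL-axiom (T ∧∙ var 0) (var 0)
    ax6  : EqMFEL-axiom (var 0 ∧∙ T) (var 0)
    ax7  : EqMFEL-axiom (var 0 ∧∙ F) (F ∧∙ var 0)
    ax8  : EqMFEL-axiom (¬' (var 0) ∧∙ F) (var 0 ∧∙ F)
    ax9  : EqMFEL-axiom ((var 0 ∧∙ F) ∨∙ var 1) ((var 0 ∨∙ T) ∧∙ var 1)
    ax10 : EqMFEL-axiom (var 0 ∨∙ (var 1 ∧∙ F)) (var 0 ∧∙ (var 1 ∨∙ T))
    ax11 : EqMFEL-axiom ((var 0 ∨∙ var 1) ∧∙ var 2)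
                        ((¬' (var 0) ∧∙ (var 1 ∧∙ var 2)) ∨∙ (var 0 ∧∙ var 2))

  infix 4 EqMFEL⊢_≈_
  data EqMFEL⊢_≈_ : Term → Term → Set where
    axiom : ∀ {l r} → EqMFEL-axiom l r → (σ : ℕ → Term) → EqMFEL⊢ l [ σ ] ≈ r [ σ ]
    refl  : ∀ {t} → EqMFEL⊢ t ≈ t
    sym   : ∀ {t u} → EqMFEL⊢ t ≈ u → EqMFEL⊢ u ≈ t
    trans : ∀ {t u v} → EqMFEL⊢ t ≈ u → EqMFEL⊢ u ≈ v → EqMFEL⊢ t ≈ v
    cong¬ : ∀ {t u} → EqMFEL⊢ t ≈ u → EqMFEL⊢ ¬' t ≈ ¬' u
    cong∧ : ∀ {t t' u u'} → EqMFEL⊢ t ≈ t' → EqMFEL⊢ u ≈ u' → EqMFEL⊢ t ∧∙ u ≈ t' ∧∙ u'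
    cong∨ : ∀ {t t' u u'} → EqMFEL⊢ t ≈ t' → EqMFEL⊢ u ≈ u' → EqMFEL⊢ t ∨∙ u ≈ t' ∨∙ u'

  replace : Tree → Tree → Tree → Tree
  replace Tt y z = y
  replace Ft y z = z
  replace (node l a r) y z = node (replace l y z) a (replace r y z)

  fe : SP → Tree
  fe T = Tt
  fe F = Ft
  fe (atom a) = node Tt a Ft
  fe (¬' p) = replace (fe p) Ft Tt
  fe (p ∧∙ q) = replace (fe p) (fe q) (replace (fe q) Ft Ft)
  fe (p ∨∙ q) = replace (fe p) (replace (fe q) Tt Tt) (fe q)

  module _ (_≟_ : DecidableEquality A) where

    L R : A → Tree → Tree
    L a Tt = Tt
    L a Ft = Ft
    L a (node x b y) with b ≟ a
    ... | yes _ = L a x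
    ... | no _ = node (L a x) b (L a y)
    R a Tt = Tt
    R a Ft = Ft
    R a (node x b y) with b ≟ a
    ... | yes _ = R a y
    ... | no _ = node (R a x) b (R a y)

    -- m; L_a and R_a do not increase size, so we recurse with fuel = size
    size : Tree → ℕ
    size Tt = 1
    size Ft = 1
    size (node x _ y) = ℕ.suc (size x Data.Nat.+ size y)
      where import Data.Nat

    m-fuel : ℕ → Tree → Tree
    m-fuel _ Tt = Tt
    m-fuel _ Ft = Ft
    m-fuel ℕ.zero t = t
    m-fuel (ℕ.suc n) (node x a y) = node (m-fuel n (L a x)) a (m-fuel n (R a y))

    m : Tree → Tree
    m t = m-fuel (size t) t

    mfe : SP → Tree
    mfe p = m (fe p)

module Submission where

-- A memorising, continuation-passing semantics ⟦ P ⟧ ρ k evaluates P under a partial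
-- valuation ρ of the atoms answered so far, asks every other atom at most once, and passes
-- the reached valuation and the value of P to k; mfe P is ⟦ P ⟧ ∅ ending in leaves.
-- Unfolded, ⟦ P ⟧ ρ k is the decision tree over the atoms of P in order of occurrence that
-- ends in k applied to the Boolean value of P. So every axiom of EqMFEL is sound: each is a
-- Boolean identity, and the memorising axiom re-evaluates x and z only after x, y, z, when
-- nothing is left to ask. Conversely P = (P ∨ T) ∧ P is derivable, and the prefix P ∨ T
-- unfolds into the derivable case split (¬ a ∧ Q[a ↦ F]) ∨ (a ∧ Q[a ↦ T]) over the atoms
-- of P; what remains is the tree mfe P read back as a term, so equal trees give derivably
-- equal terms.

open import Defs
open import Relation.Binary.Definitions using (DecidableEquality)
open import Relation.Binary.PropositionalEquality using (_≡_; refl; cong; cong₂; module ≡-Reasoning)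
import Relation.Binary.PropositionalEquality as ≡
open import Relation.Binary.Core using (Rel; _Preserves₂_⟶_⟶_)
open import Data.Nat using (ℕ; zero; suc; _≤_; s≤s)
open import Data.Nat.Properties using (≤-refl; ≤-trans; m≤m+n; m≤n+m; n≤1+n)
open import Data.Bool using (Bool; true; false; not; _∧_; _∨_; if_then_else_)
import Data.Bool.Properties as Bool
open import Data.Maybe using (Maybe; just; nothing; maybe′; fromMaybe)
open import Data.List using (List; []; _∷_; _++_)
open import Data.List.Relation.Unary.All as All using (All; []; _∷_)
open import Data.List.Relation.Unary.All.Properties using (++⁻ˡ; ++⁻ʳ)
open import Data.Product using (∃; _×_; _,_; proj₁)
open import Data.Empty using (⊥-elim)
open import Relation.Nullary using (yes; no; contradiction)
open import Level using (Level)
open import Function.Bundles using (_⇔_; mk⇔)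
open import Relation.Binary.Bundles using (Setoid)
import Relation.Binary.Reasoning.Setoid as SetoidReasoning

-- Consequences of EqMFEL

module Derivable (A : Set) where

  infix 4 _≈_
  _≈_ : Term A → Term A → Set
  _≈_ = EqMFEL⊢_≈_ A

  ≈-setoid : Setoid _ _
  ≈-setoid = record
    { Carrier = Term A
    ; _≈_ = _≈_
    ; isEquivalence = record { refl = refl ; sym = sym ; trans = trans }
    }

  open SetoidReasoning ≈-setoid

  sub₃ : Term A → Term A → Term A → ℕ → Term A
  sub₃ x y z zero = x
  sub₃ x y z (suc zero) = y
  sub₃ x y z (suc (suc _)) = z

  F≈¬T : F ≈ ¬' T
  F≈¬T = axiom ax1 (sub₃ T T T)

  ∨-def : ∀ x y → x ∨∙ y ≈ ¬' (¬' x ∧∙ ¬' y)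
  ∨-def x y = axiom ax2 (sub₃ x y T)

  ¬-involutive : ∀ x → ¬' (¬' x) ≈ x
  ¬-involutive x = axiom ax3 (sub₃ x T T)

  ∧-assoc : ∀ x y z → (x ∧∙ y) ∧∙ z ≈ x ∧∙ (y ∧∙ z)
  ∧-assoc x y z = axiom ax4 (sub₃ x y z)

  ∧-identityˡ : ∀ x → T ∧∙ x ≈ x
  ∧-identityˡ x = axiom ax5 (sub₃ x T T)

  ∧-identityʳ : ∀ x → x ∧∙ T ≈ x
  ∧-identityʳ x = axiom ax6 (sub₃ x T T)

  ∧F≈F∧ : ∀ x → x ∧∙ F ≈ F ∧∙ x
  ∧F≈F∧ x = axiom ax7 (sub₃ x T T)

  ¬∧F≈∧F : ∀ x → ¬' x ∧∙ F ≈ x ∧∙ F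
  ¬∧F≈∧F x = axiom ax8 (sub₃ x T T)

  ∧F-∨ : ∀ x y → (x ∧∙ F) ∨∙ y ≈ (x ∨∙ T) ∧∙ y
  ∧F-∨ x y = axiom ax9 (sub₃ x y T)

  ∨-∧F : ∀ x y → x ∨∙ (y ∧∙ F) ≈ x ∧∙ (y ∨∙ T)
  ∨-∧F x y = axiom ax10 (sub₃ x y T)

  ∨-∧-cases : ∀ x y z → (x ∨∙ y) ∧∙ z ≈ (¬' x ∧∙ (y ∧∙ z)) ∨∙ (x ∧∙ z)
  ∨-∧-cases x y z = axiom ax11 (sub₃ x y z)

  ¬F≈T : ¬' F ≈ T
  ¬F≈T = trans (cong¬ F≈¬T) (¬-involutive T)

  ∨-identityʳ : ∀ x → x ∨∙ F ≈ x
  ∨-identityʳ x = begin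
    x ∨∙ F              ≈⟨ ∨-def x F ⟩
    ¬' (¬' x ∧∙ ¬' F)   ≈⟨ cong¬ (cong∧ refl ¬F≈T) ⟩
    ¬' (¬' x ∧∙ T)      ≈⟨ cong¬ (∧-identityʳ (¬' x)) ⟩
    ¬' (¬' x)           ≈⟨ ¬-involutive x ⟩
    x                   ∎

  ∨-identityˡ : ∀ x → F ∨∙ x ≈ x
  ∨-identityˡ x = begin
    F ∨∙ x              ≈⟨ ∨-def F x ⟩
    ¬' (¬' F ∧∙ ¬' x)   ≈⟨ cong¬ (cong∧ ¬F≈T refl) ⟩
    ¬' (T ∧∙ ¬' x)      ≈⟨ cong¬ (∧-identityˡ (¬' x)) ⟩
    ¬' (¬' x)           ≈⟨ ¬-involutive x ⟩
    x                   ∎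

  ¬-∧ : ∀ x y → ¬' (x ∧∙ y) ≈ ¬' x ∨∙ ¬' y
  ¬-∧ x y = begin
    ¬' (x ∧∙ y)                   ≈⟨ cong¬ (cong∧ (¬-involutive x) (¬-involutive y)) ⟨
    ¬' (¬' (¬' x) ∧∙ ¬' (¬' y))   ≈⟨ ∨-def (¬' x) (¬' y) ⟨
    ¬' x ∨∙ ¬' y                  ∎

  ¬-∨ : ∀ x y → ¬' (x ∨∙ y) ≈ ¬' x ∧∙ ¬' y
  ¬-∨ x y = trans (cong¬ (∨-def x y)) (¬-involutive (¬' x ∧∙ ¬' y))

  F∧F≈F : F ∧∙ F ≈ F
  F∧F≈F = begin
    F ∧∙ F      ≈⟨ cong∧ F≈¬T refl ⟩
    ¬' T ∧∙ F   ≈⟨ ¬∧F≈∧F T ⟩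
    T ∧∙ F      ≈⟨ ∧-identityˡ F ⟩
    F           ∎

  ∨-∧-casesᵀ : ∀ x z → (x ∨∙ T) ∧∙ z ≈ (¬' x ∧∙ z) ∨∙ (x ∧∙ z)
  ∨-∧-casesᵀ x z = trans (∨-∧-cases x T z) (cong∨ (cong∧ refl (∧-identityˡ z)) refl)

  ∨T-∧-absorb : ∀ x → (x ∨∙ T) ∧∙ x ≈ x
  ∨T-∧-absorb x = begin
    (x ∨∙ T) ∧∙ x                          ≈⟨ ∧F-∨ x x ⟨
    (x ∧∙ F) ∨∙ x                          ≈⟨ cong∨ (¬∧F≈∧F x) (∧-identityʳ x) ⟨
    (¬' x ∧∙ F) ∨∙ (x ∧∙ T)                ≈⟨ cong∨ (cong∧ refl (∧-identityʳ F)) refl ⟨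
    (¬' x ∧∙ (F ∧∙ T)) ∨∙ (x ∧∙ T)         ≈⟨ ∨-∧-cases x F T ⟨
    (x ∨∙ F) ∧∙ T                          ≈⟨ ∧-identityʳ (x ∨∙ F) ⟩
    x ∨∙ F                                 ≈⟨ ∨-identityʳ x ⟩
    x                                      ∎

  ∨-expand : ∀ x y → x ∨∙ y ≈ (¬' x ∧∙ y) ∨∙ x
  ∨-expand x y = begin
    x ∨∙ y                              ≈⟨ ∧-identityʳ (x ∨∙ y) ⟨
    (x ∨∙ y) ∧∙ T                       ≈⟨ ∨-∧-cases x y T ⟩
    (¬' x ∧∙ (y ∧∙ T)) ∨∙ (x ∧∙ T)      ≈⟨ cong∨ (cong∧ refl (∧-identityʳ y)) (∧-identityʳ x) ⟩
    (¬' x ∧∙ y) ∨∙ x                    ∎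

  ∧-expand : ∀ x y → x ∧∙ y ≈ (¬' x ∨∙ y) ∧∙ x
  ∧-expand x y = begin
    x ∧∙ y                                   ≈⟨ ¬-involutive (x ∧∙ y) ⟨
    ¬' (¬' (x ∧∙ y))                         ≈⟨ cong¬ (¬-∧ x y) ⟩
    ¬' (¬' x ∨∙ ¬' y)                        ≈⟨ cong¬ (∨-expand (¬' x) (¬' y)) ⟩
    ¬' ((¬' (¬' x) ∧∙ ¬' y) ∨∙ ¬' x)         ≈⟨ cong¬ (cong∨ (¬-∨ (¬' x) y) refl) ⟨
    ¬' (¬' (¬' x ∨∙ y) ∨∙ ¬' x)              ≈⟨ cong¬ (¬-∧ (¬' x ∨∙ y) x) ⟨
    ¬' (¬' ((¬' x ∨∙ y) ∧∙ x))               ≈⟨ ¬-involutive ((¬' x ∨∙ y) ∧∙ x) ⟩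
    (¬' x ∨∙ y) ∧∙ x                         ∎

  ∧-∨T-absorb : ∀ y z → y ∧∙ z ≈ (y ∧∙ z) ∧∙ (z ∨∙ T)
  ∧-∨T-absorb y z = begin
    y ∧∙ z                                   ≈⟨ cong∧ (∨-identityˡ y) refl ⟨
    (F ∨∙ y) ∧∙ z                            ≈⟨ ∨-∧-cases F y z ⟩
    (¬' F ∧∙ (y ∧∙ z)) ∨∙ (F ∧∙ z)           ≈⟨ cong∨ (cong∧ ¬F≈T refl) (sym (∧F≈F∧ z)) ⟩
    (T ∧∙ (y ∧∙ z)) ∨∙ (z ∧∙ F)              ≈⟨ cong∨ (∧-identityˡ (y ∧∙ z)) refl ⟩
    (y ∧∙ z) ∨∙ (z ∧∙ F)                     ≈⟨ ∨-∧F (y ∧∙ z) z ⟩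
    (y ∧∙ z) ∧∙ (z ∨∙ T)                     ∎

  ∧-idem : ∀ x → x ∧∙ x ≈ x
  ∧-idem x = begin
    x ∧∙ x                     ≈⟨ ∧-expand x x ⟩
    (¬' x ∨∙ x) ∧∙ x           ≈⟨ cong∧ (cong∨ (∧-identityʳ (¬' x)) refl) refl ⟨
    ((¬' x ∧∙ T) ∨∙ x) ∧∙ x    ≈⟨ cong∧ (∨-expand x T) refl ⟨
    (x ∨∙ T) ∧∙ x              ≈⟨ ∨T-∧-absorb x ⟩
    x                          ∎

  ∧-¬ : ∀ x → x ∧∙ ¬' x ≈ x ∧∙ F
  ∧-¬ x = begin
    x ∧∙ ¬' x                        ≈⟨ cong∧ (¬-involutive x) refl ⟨
    ¬' (¬' x) ∧∙ ¬' x                ≈⟨ cong∧ (∨-identityʳ (¬' (¬' x))) refl ⟨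
    (¬' (¬' x) ∨∙ F) ∧∙ ¬' x         ≈⟨ ∧-expand (¬' x) F ⟨
    ¬' x ∧∙ F                        ≈⟨ ¬∧F≈∧F x ⟩
    x ∧∙ F                           ∎

  ∧-repeat : ∀ x y → x ∧∙ (y ∧∙ x) ≈ x ∧∙ y
  ∧-repeat x y = begin
    x ∧∙ (y ∧∙ x)              ≈⟨ ∧-assoc x y x ⟨
    (x ∧∙ y) ∧∙ x              ≈⟨ cong∧ (∧-expand x y) refl ⟩
    ((¬' x ∨∙ y) ∧∙ x) ∧∙ x    ≈⟨ ∧-assoc (¬' x ∨∙ y) x x ⟩
    (¬' x ∨∙ y) ∧∙ (x ∧∙ x)    ≈⟨ cong∧ refl (∧-idem x) ⟩
    (¬' x ∨∙ y) ∧∙ x           ≈⟨ ∧-expand x y ⟨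
    x ∧∙ y                     ∎

  ∧-repeat-¬ : ∀ x y → x ∧∙ (y ∧∙ ¬' x) ≈ x ∧∙ (y ∧∙ F)
  ∧-repeat-¬ x y = begin
    x ∧∙ (y ∧∙ ¬' x)              ≈⟨ ∧-assoc x y (¬' x) ⟨
    (x ∧∙ y) ∧∙ ¬' x              ≈⟨ cong∧ (∧-expand x y) refl ⟩
    ((¬' x ∨∙ y) ∧∙ x) ∧∙ ¬' x    ≈⟨ ∧-assoc (¬' x ∨∙ y) x (¬' x) ⟩
    (¬' x ∨∙ y) ∧∙ (x ∧∙ ¬' x)    ≈⟨ cong∧ refl (∧-¬ x) ⟩
    (¬' x ∨∙ y) ∧∙ (x ∧∙ F)       ≈⟨ ∧-assoc (¬' x ∨∙ y) x F ⟨
    ((¬' x ∨∙ y) ∧∙ x) ∧∙ F       ≈⟨ cong∧ (∧-expand x y) refl ⟨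
    (x ∧∙ y) ∧∙ F                 ≈⟨ ∧-assoc x y F ⟩
    x ∧∙ (y ∧∙ F)                 ∎

  ∧-∨T-repeat : ∀ x y → (x ∧∙ y) ∧∙ (x ∨∙ T) ≈ x ∧∙ y
  ∧-∨T-repeat x y = begin
    (x ∧∙ y) ∧∙ (x ∨∙ T)              ≈⟨ cong∧ (∧-expand x y) refl ⟩
    ((¬' x ∨∙ y) ∧∙ x) ∧∙ (x ∨∙ T)    ≈⟨ ∧-∨T-absorb (¬' x ∨∙ y) x ⟨
    (¬' x ∨∙ y) ∧∙ x                  ≈⟨ ∧-expand x y ⟨
    x ∧∙ y                            ∎

  ¬-∨T : ∀ x → ¬' x ∨∙ T ≈ x ∨∙ T
  ¬-∨T x = begin
    ¬' x ∨∙ T            ≈⟨ cong∨ refl ¬F≈T ⟨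
    ¬' x ∨∙ ¬' F         ≈⟨ ¬-∧ x F ⟨
    ¬' (x ∧∙ F)          ≈⟨ cong¬ (¬∧F≈∧F x) ⟨
    ¬' (¬' x ∧∙ F)       ≈⟨ cong¬ (cong∧ refl F≈¬T) ⟩
    ¬' (¬' x ∧∙ ¬' T)    ≈⟨ ∨-def x T ⟨
    x ∨∙ T               ∎

  ∧-∨T : ∀ x y → (x ∧∙ y) ∨∙ T ≈ (x ∨∙ T) ∧∙ (y ∨∙ T)
  ∧-∨T x y = begin
    (x ∧∙ y) ∨∙ T                          ≈⟨ ∨-def (x ∧∙ y) T ⟩
    ¬' (¬' (x ∧∙ y) ∧∙ ¬' T)               ≈⟨ cong¬ (cong∧ refl F≈¬T) ⟨
    ¬' (¬' (x ∧∙ y) ∧∙ F)                  ≈⟨ cong¬ (¬∧F≈∧F (x ∧∙ y)) ⟩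
    ¬' ((x ∧∙ y) ∧∙ F)                     ≈⟨ cong¬ (∧-assoc x y F) ⟩
    ¬' (x ∧∙ (y ∧∙ F))                     ≈⟨ cong¬ (cong∧ refl (cong∧ refl F∧F≈F)) ⟨
    ¬' (x ∧∙ (y ∧∙ (F ∧∙ F)))              ≈⟨ cong¬ (cong∧ refl (∧-assoc y F F)) ⟨
    ¬' (x ∧∙ ((y ∧∙ F) ∧∙ F))              ≈⟨ cong¬ (cong∧ refl (¬∧F≈∧F (y ∧∙ F))) ⟨
    ¬' (x ∧∙ (¬' (y ∧∙ F) ∧∙ F))           ≈⟨ cong¬ (cong∧ refl (∧F≈F∧ (¬' (y ∧∙ F)))) ⟩
    ¬' (x ∧∙ (F ∧∙ ¬' (y ∧∙ F)))           ≈⟨ cong¬ (∧-assoc x F (¬' (y ∧∙ F))) ⟨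
    ¬' ((x ∧∙ F) ∧∙ ¬' (y ∧∙ F))           ≈⟨ cong¬ (cong∧ (¬∧F≈∧F x) refl) ⟨
    ¬' ((¬' x ∧∙ F) ∧∙ ¬' (y ∧∙ F))        ≈⟨ cong¬ (cong∧ (cong∧ refl F≈¬T) refl) ⟩
    ¬' ((¬' x ∧∙ ¬' T) ∧∙ ¬' (y ∧∙ F))     ≈⟨ cong¬ (cong∧ (¬-∨ x T) refl) ⟨
    ¬' (¬' (x ∨∙ T) ∧∙ ¬' (y ∧∙ F))        ≈⟨ ∨-def (x ∨∙ T) (y ∧∙ F) ⟨
    (x ∨∙ T) ∨∙ (y ∧∙ F)                   ≈⟨ ∨-∧F (x ∨∙ T) y ⟩
    (x ∨∙ T) ∧∙ (y ∨∙ T)                   ∎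

  ∨-∨T : ∀ x y → (x ∨∙ y) ∨∙ T ≈ (x ∨∙ T) ∧∙ (y ∨∙ T)
  ∨-∨T x y = begin
    (x ∨∙ y) ∨∙ T                ≈⟨ ¬-∨T (x ∨∙ y) ⟨
    ¬' (x ∨∙ y) ∨∙ T             ≈⟨ cong∨ (¬-∨ x y) refl ⟩
    (¬' x ∧∙ ¬' y) ∨∙ T          ≈⟨ ∧-∨T (¬' x) (¬' y) ⟩
    (¬' x ∨∙ T) ∧∙ (¬' y ∨∙ T)   ≈⟨ cong∧ (¬-∨T x) (¬-∨T y) ⟩
    (x ∨∙ T) ∧∙ (y ∨∙ T)         ∎

  T∨T≈T : T ∨∙ T ≈ T
  T∨T≈T = trans (sym (∧-identityʳ (T ∨∙ T))) (∨T-∧-absorb T)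

  ∨-assoc : ∀ x y z → (x ∨∙ y) ∨∙ z ≈ x ∨∙ (y ∨∙ z)
  ∨-assoc x y z = begin
    (x ∨∙ y) ∨∙ z                   ≈⟨ ∨-def (x ∨∙ y) z ⟩
    ¬' (¬' (x ∨∙ y) ∧∙ ¬' z)        ≈⟨ cong¬ (cong∧ (¬-∨ x y) refl) ⟩
    ¬' ((¬' x ∧∙ ¬' y) ∧∙ ¬' z)     ≈⟨ cong¬ (∧-assoc (¬' x) (¬' y) (¬' z)) ⟩
    ¬' (¬' x ∧∙ (¬' y ∧∙ ¬' z))     ≈⟨ cong¬ (cong∧ refl (¬-∨ y z)) ⟨
    ¬' (¬' x ∧∙ ¬' (y ∨∙ z))        ≈⟨ ∨-def x (y ∨∙ z) ⟨
    x ∨∙ (y ∨∙ z)                   ∎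

  ∧-distribˡ-∨ : ∀ x y z → x ∧∙ (y ∨∙ z) ≈ (x ∧∙ y) ∨∙ (x ∧∙ z)
  ∧-distribˡ-∨ x y z = begin
    x ∧∙ (y ∨∙ z)                          ≈⟨ ∧-expand x (y ∨∙ z) ⟩
    (¬' x ∨∙ (y ∨∙ z)) ∧∙ x                ≈⟨ cong∧ (∨-assoc (¬' x) y z) refl ⟨
    ((¬' x ∨∙ y) ∨∙ z) ∧∙ x                ≈⟨ ∨-∧-cases (¬' x ∨∙ y) z x ⟩
    (¬' (¬' x ∨∙ y) ∧∙ (z ∧∙ x)) ∨∙ ((¬' x ∨∙ y) ∧∙ x)
      ≈⟨ cong∨ (cong∧ (trans (¬-∨ (¬' x) y) (cong∧ (¬-involutive x) refl)) refl) (sym (∧-expand x y)) ⟩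
    ((x ∧∙ ¬' y) ∧∙ (z ∧∙ x)) ∨∙ (x ∧∙ y)  ≈⟨ cong∨ x¬y-zx refl ⟩
    (x ∧∙ (¬' y ∧∙ z)) ∨∙ (x ∧∙ y)         ≈⟨ cong∨ ¬xy-xz refl ⟨
    (¬' (x ∧∙ y) ∧∙ (x ∧∙ z)) ∨∙ (x ∧∙ y)  ≈⟨ ∨-expand (x ∧∙ y) (x ∧∙ z) ⟨
    (x ∧∙ y) ∨∙ (x ∧∙ z)                   ∎
    where
    x¬y-zx : (x ∧∙ ¬' y) ∧∙ (z ∧∙ x) ≈ x ∧∙ (¬' y ∧∙ z)
    x¬y-zx = begin
      (x ∧∙ ¬' y) ∧∙ (z ∧∙ x)     ≈⟨ ∧-assoc x (¬' y) (z ∧∙ x) ⟩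
      x ∧∙ (¬' y ∧∙ (z ∧∙ x))     ≈⟨ cong∧ refl (∧-assoc (¬' y) z x) ⟨
      x ∧∙ ((¬' y ∧∙ z) ∧∙ x)     ≈⟨ ∧-repeat x (¬' y ∧∙ z) ⟩
      x ∧∙ (¬' y ∧∙ z)            ∎
    x¬y-xz : x ∧∙ (¬' y ∧∙ (x ∧∙ z)) ≈ x ∧∙ (¬' y ∧∙ z)
    x¬y-xz = begin
      x ∧∙ (¬' y ∧∙ (x ∧∙ z))     ≈⟨ cong∧ refl (∧-assoc (¬' y) x z) ⟨
      x ∧∙ ((¬' y ∧∙ x) ∧∙ z)     ≈⟨ ∧-assoc x (¬' y ∧∙ x) z ⟨
      (x ∧∙ (¬' y ∧∙ x)) ∧∙ z     ≈⟨ cong∧ (∧-repeat x (¬' y)) refl ⟩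
      (x ∧∙ ¬' y) ∧∙ z            ≈⟨ ∧-assoc x (¬' y) z ⟩
      x ∧∙ (¬' y ∧∙ z)            ∎
    ¬x-xz : ¬' x ∧∙ (x ∧∙ z) ≈ (x ∧∙ z) ∧∙ F
    ¬x-xz = begin
      ¬' x ∧∙ (x ∧∙ z)            ≈⟨ ∧-assoc (¬' x) x z ⟨
      (¬' x ∧∙ x) ∧∙ z            ≈⟨ cong∧ (cong∧ refl (¬-involutive x)) refl ⟨
      (¬' x ∧∙ ¬' (¬' x)) ∧∙ z    ≈⟨ cong∧ (trans (∧-¬ (¬' x)) (¬∧F≈∧F x)) refl ⟩
      (x ∧∙ F) ∧∙ z               ≈⟨ ∧-assoc x F z ⟩
      x ∧∙ (F ∧∙ z)               ≈⟨ cong∧ refl (∧F≈F∧ z) ⟨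
      x ∧∙ (z ∧∙ F)               ≈⟨ ∧-assoc x z F ⟨
      (x ∧∙ z) ∧∙ F               ∎
    ¬xy-xz : ¬' (x ∧∙ y) ∧∙ (x ∧∙ z) ≈ x ∧∙ (¬' y ∧∙ z)
    ¬xy-xz = begin
      ¬' (x ∧∙ y) ∧∙ (x ∧∙ z)                               ≈⟨ cong∧ (¬-∧ x y) refl ⟩
      (¬' x ∨∙ ¬' y) ∧∙ (x ∧∙ z)                            ≈⟨ ∨-∧-cases (¬' x) (¬' y) (x ∧∙ z) ⟩
      (¬' (¬' x) ∧∙ (¬' y ∧∙ (x ∧∙ z))) ∨∙ (¬' x ∧∙ (x ∧∙ z))
        ≈⟨ cong∨ (trans (cong∧ (¬-involutive x) refl) x¬y-xz) ¬x-xz ⟩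
      (x ∧∙ (¬' y ∧∙ z)) ∨∙ ((x ∧∙ z) ∧∙ F)                 ≈⟨ ∨-∧F (x ∧∙ (¬' y ∧∙ z)) (x ∧∙ z) ⟩
      (x ∧∙ (¬' y ∧∙ z)) ∧∙ ((x ∧∙ z) ∨∙ T)                 ≈⟨ cong∧ refl (∧-∨T x z) ⟩
      (x ∧∙ (¬' y ∧∙ z)) ∧∙ ((x ∨∙ T) ∧∙ (z ∨∙ T))          ≈⟨ ∧-assoc _ _ _ ⟨
      ((x ∧∙ (¬' y ∧∙ z)) ∧∙ (x ∨∙ T)) ∧∙ (z ∨∙ T)          ≈⟨ cong∧ (∧-∨T-repeat x (¬' y ∧∙ z)) refl ⟩
      (x ∧∙ (¬' y ∧∙ z)) ∧∙ (z ∨∙ T)                        ≈⟨ ∧-assoc _ _ _ ⟩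
      x ∧∙ ((¬' y ∧∙ z) ∧∙ (z ∨∙ T))                        ≈⟨ cong∧ refl (∧-∨T-absorb (¬' y) z) ⟨
      x ∧∙ (¬' y ∧∙ z)                                      ∎

  -- Once ℓ is evaluated, x and y are interchangeable behind any prefix W; quantifying over W
  -- makes the notion closed under ∧ and ∨.
  Guarded : Term A → Term A → Term A → Set
  Guarded ℓ x y = ∀ W → ℓ ∧∙ (W ∧∙ x) ≈ ℓ ∧∙ (W ∧∙ y)

  Guarded-resp : ∀ {ℓ x x' y y'} → x ≈ x' → y ≈ y' → Guarded ℓ x' y' → Guarded ℓ x y
  Guarded-resp x≈x' y≈y' g W = trans (cong∧ refl (cong∧ refl x≈x')) (trans (g W) (cong∧ refl (cong∧ refl (sym y≈y'))))

  Guarded-∧ : ∀ {ℓ x x' y y'} → Guarded ℓ x x' → Guarded ℓ y y' → Guarded ℓ (x ∧∙ y) (x' ∧∙ y')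
  Guarded-∧ {ℓ} {x} {x'} {y} {y'} gx gy W = begin
    ℓ ∧∙ (W ∧∙ (x ∧∙ y))       ≈⟨ cong∧ refl (∧-assoc W x y) ⟨
    ℓ ∧∙ ((W ∧∙ x) ∧∙ y)       ≈⟨ gy (W ∧∙ x) ⟩
    ℓ ∧∙ ((W ∧∙ x) ∧∙ y')      ≈⟨ ∧-assoc ℓ (W ∧∙ x) y' ⟨
    (ℓ ∧∙ (W ∧∙ x)) ∧∙ y'      ≈⟨ cong∧ (gx W) refl ⟩
    (ℓ ∧∙ (W ∧∙ x')) ∧∙ y'     ≈⟨ ∧-assoc ℓ (W ∧∙ x') y' ⟩
    ℓ ∧∙ ((W ∧∙ x') ∧∙ y')     ≈⟨ cong∧ refl (∧-assoc W x' y') ⟩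
    ℓ ∧∙ (W ∧∙ (x' ∧∙ y'))     ∎

  Guarded-∨ : ∀ {ℓ x x' y y'} → Guarded ℓ x x' → Guarded ℓ y y' → Guarded ℓ (x ∨∙ y) (x' ∨∙ y')
  Guarded-∨ {ℓ} {x} {x'} {y} {y'} gx gy W = begin
    ℓ ∧∙ (W ∧∙ (x ∨∙ y))                       ≈⟨ ∧-assoc ℓ W (x ∨∙ y) ⟨
    (ℓ ∧∙ W) ∧∙ (x ∨∙ y)                       ≈⟨ ∧-distribˡ-∨ (ℓ ∧∙ W) x y ⟩
    ((ℓ ∧∙ W) ∧∙ x) ∨∙ ((ℓ ∧∙ W) ∧∙ y)         ≈⟨ cong∨ (reassoc gx) (reassoc gy) ⟩
    ((ℓ ∧∙ W) ∧∙ x') ∨∙ ((ℓ ∧∙ W) ∧∙ y')       ≈⟨ ∧-distribˡ-∨ (ℓ ∧∙ W) x' y' ⟨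
    (ℓ ∧∙ W) ∧∙ (x' ∨∙ y')                     ≈⟨ ∧-assoc ℓ W (x' ∨∙ y') ⟩
    ℓ ∧∙ (W ∧∙ (x' ∨∙ y'))                     ∎
    where
    reassoc : ∀ {z z'} → Guarded ℓ z z' → (ℓ ∧∙ W) ∧∙ z ≈ (ℓ ∧∙ W) ∧∙ z'
    reassoc {z} {z'} g = trans (∧-assoc ℓ W z) (trans (g W) (sym (∧-assoc ℓ W z')))

  Guarded⇒∧ : ∀ {ℓ x y} → Guarded ℓ x y → ℓ ∧∙ x ≈ ℓ ∧∙ y
  Guarded⇒∧ {ℓ} {x} {y} g = begin
    ℓ ∧∙ x           ≈⟨ cong∧ refl (∧-identityˡ x) ⟨
    ℓ ∧∙ (T ∧∙ x)    ≈⟨ g T ⟩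
    ℓ ∧∙ (T ∧∙ y)    ≈⟨ cong∧ refl (∧-identityˡ y) ⟩
    ℓ ∧∙ y           ∎

module _ (A : Set) (_≟_ : DecidableEquality A) where

  open Derivable A

  ⌈_⌉ : SP A → Term A
  ⌈_⌉ = ⌜_⌝ A

  -- Partial valuations and memorising decisions

  PVal : Set
  PVal = A → Maybe Bool

  ∅ : PVal
  ∅ _ = nothing

  _[_≔_] : PVal → A → Bool → PVal
  (ρ [ a ≔ b ]) x with x ≟ a
  ... | yes _ = just b
  ... | no _ = ρ x

  infix 4 _⊑_
  _⊑_ : PVal → PVal → Set
  ρ ⊑ ρ' = ∀ x {b} → ρ x ≡ just b → ρ' x ≡ just b

  ⊑-refl : ∀ {ρ} → ρ ⊑ ρ
  ⊑-refl _ e = e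

  ⊑-trans : ∀ {ρ ρ' ρ''} → ρ ⊑ ρ' → ρ' ⊑ ρ'' → ρ ⊑ ρ''
  ⊑-trans h h' x e = h' x (h x e)

  [≔]-self : ∀ ρ a b → (ρ [ a ≔ b ]) a ≡ just b
  [≔]-self ρ a b with a ≟ a
  ... | yes _ = refl
  ... | no a≢a = ⊥-elim (a≢a refl)

  ⊑-[≔] : ∀ {ρ a} b → ρ a ≡ nothing → ρ ⊑ ρ [ a ≔ b ]
  ⊑-[≔] {ρ} {a} b ρa≡nothing x e with x ≟ a
  ... | yes refl = contradiction (≡.trans (≡.sym e) ρa≡nothing) λ ()
  ... | no _ = e

  Known : PVal → A → Set
  Known ρ a = ∃ λ b → ρ a ≡ just b

  ⊑-Known : ∀ {ρ ρ'} → ρ ⊑ ρ' → ∀ {a} → Known ρ a → Known ρ' a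
  ⊑-Known ρ⊑ρ' {a} (b , e) = b , ρ⊑ρ' a e

  module _ {X : Set} (branch : A → X → X → X) where

    ask : PVal → A → (PVal → Bool → X) → X
    ask ρ a κ = maybe′ (κ ρ) (branch a (κ (ρ [ a ≔ true ]) true) (κ (ρ [ a ≔ false ]) false)) (ρ a)

    decide : PVal → List A → (PVal → X) → X
    decide ρ [] g = g ρ
    decide ρ (a ∷ as) g = ask ρ a (λ ρ' _ → decide ρ' as g)

    ask-known : ∀ {ρ a b} κ → ρ a ≡ just b → ask ρ a κ ≡ κ ρ b
    ask-known {ρ} {a} κ e rewrite e = refl

    decide-known : ∀ {ρ} as g → All (Known ρ) as → decide ρ as g ≡ g ρ
    decide-known [] g [] = refl
    decide-known (a ∷ as) g ((_ , e) ∷ known) =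
      ≡.trans (ask-known (λ ρ' _ → decide ρ' as g) e) (decide-known as g known)

    module _ {ℓ : Level} (_∼_ : Rel X ℓ) (branch-cong : ∀ a → branch a Preserves₂ _∼_ ⟶ _∼_ ⟶ _∼_) where

      ask-cong : ∀ ρ a {κ κ'} → (∀ ρ' b → ρ ⊑ ρ' → ρ' a ≡ just b → κ ρ' b ∼ κ' ρ' b) →
                 ask ρ a κ ∼ ask ρ a κ'
      ask-cong ρ a h with ρ a in e
      ... | just b = h ρ b ⊑-refl e
      ... | nothing = branch-cong a (h _ true (⊑-[≔] true e) ([≔]-self ρ a true))
                                    (h _ false (⊑-[≔] false e) ([≔]-self ρ a false))

      decide-cong : ∀ ρ as {g g'} → (∀ ρ' → ρ ⊑ ρ' → All (Known ρ') as → g ρ' ∼ g' ρ') →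
                    decide ρ as g ∼ decide ρ as g'
      decide-cong ρ [] h = h ρ ⊑-refl []
      decide-cong ρ (a ∷ as) h = ask-cong ρ a λ ρ' b ρ⊑ρ' e →
        decide-cong ρ' as λ ρ'' ρ'⊑ρ'' known →
          h ρ'' (⊑-trans ρ⊑ρ' ρ'⊑ρ'') ((b , ρ'⊑ρ'' a e) ∷ known)

    ask-cong≡ : ∀ ρ a {κ κ'} → (∀ ρ' b → ρ ⊑ ρ' → ρ' a ≡ just b → κ ρ' b ≡ κ' ρ' b) →
                ask ρ a κ ≡ ask ρ a κ'
    ask-cong≡ = ask-cong _≡_ (λ a → cong₂ (branch a))

    decide-cong≡ : ∀ ρ as {g g'} → (∀ ρ' → ρ ⊑ ρ' → All (Known ρ') as → g ρ' ≡ g' ρ') →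
                   decide ρ as g ≡ decide ρ as g'
    decide-cong≡ = decide-cong _≡_ (λ a → cong₂ (branch a))

    decide-++ : ∀ ρ as bs g → decide ρ (as ++ bs) g ≡ decide ρ as (λ ρ' → decide ρ' bs g)
    decide-++ ρ [] bs g = refl
    decide-++ ρ (a ∷ as) bs g =
      ask-cong≡ ρ a λ ρ' _ _ _ → decide-++ ρ' as bs g

  decide-map : ∀ {X Y : Set} {branch₁ : A → X → X → X} {branch₂ : A → Y → Y → Y} (f : X → Y) →
               (∀ a l r → f (branch₁ a l r) ≡ branch₂ a (f l) (f r)) →
               ∀ ρ as g → f (decide branch₁ ρ as g) ≡ decide branch₂ ρ as (λ ρ' → f (g ρ'))
  decide-map f f-branch ρ [] g = refl
  decide-map {branch₂ = branch₂} f f-branch ρ (a ∷ as) g with ρ a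
  ... | just _ = decide-map f f-branch ρ as g
  ... | nothing = ≡.trans (f-branch a _ _)
        (cong₂ (branch₂ a) (decide-map f f-branch _ as g) (decide-map f f-branch _ as g))

  -- Memorising evaluation of trees and terms

  nodeAt : A → Tree A → Tree A → Tree A
  nodeAt a l r = node l a r

  Cont : Set
  Cont = PVal → Bool → Tree A

  run : PVal → Tree A → Cont → Tree A
  run ρ Tt k = k ρ true
  run ρ Ft k = k ρ false
  run ρ (node l a r) k = ask nodeAt ρ a λ ρ' b → if b then run ρ' l k else run ρ' r k

  run-cong : ∀ ρ t {k k' : Cont} → (∀ ρ' b → k ρ' b ≡ k' ρ' b) → run ρ t k ≡ run ρ t k'
  run-cong ρ Tt h = h ρ true
  run-cong ρ Ft h = h ρ false
  run-cong ρ (node l a r) h = ask-cong≡ nodeAt ρ a λ ρ' b _ _ →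
    Bool.if-cong₂ b (run-cong ρ' l h) (run-cong ρ' r h)

  run-replace : ∀ ρ t y z k →
                run ρ (replace A t y z) k ≡ run ρ t (λ ρ' b → if b then run ρ' y k else run ρ' z k)
  run-replace ρ Tt y z k = refl
  run-replace ρ Ft y z k = refl
  run-replace ρ (node l a r) y z k = ask-cong≡ nodeAt ρ a λ ρ' b _ _ →
    Bool.if-cong₂ b (run-replace ρ' l y z k) (run-replace ρ' r y z k)

  run-replace-same : ∀ ρ t y k → run ρ (replace A t y y) k ≡ run ρ t (λ ρ' _ → run ρ' y k)
  run-replace-same ρ t y k =
    ≡.trans (run-replace ρ t y y k) (run-cong ρ t λ _ b → Bool.if-eta b)

  Sem : Set
  Sem = PVal → Cont → Tree A

  seqWith : (Bool → Bool → Bool) → Sem → Sem → Sem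
  seqWith _⊕_ d e ρ k = d ρ λ ρ' b → e ρ' λ ρ'' c → k ρ'' (b ⊕ c)

  ⟦_⟧ : SP A → Sem
  ⟦ T ⟧ ρ k = k ρ true
  ⟦ F ⟧ ρ k = k ρ false
  ⟦ atom a ⟧ ρ k = ask nodeAt ρ a k
  ⟦ ¬' P ⟧ ρ k = ⟦ P ⟧ ρ λ ρ' b → k ρ' (not b)
  ⟦ P ∧∙ Q ⟧ = seqWith _∧_ ⟦ P ⟧ ⟦ Q ⟧
  ⟦ P ∨∙ Q ⟧ = seqWith _∨_ ⟦ P ⟧ ⟦ Q ⟧

  run-fe : ∀ P ρ k → run ρ (fe A P) k ≡ ⟦ P ⟧ ρ k
  run-fe T ρ k = refl
  run-fe F ρ k = refl
  run-fe (atom a) ρ k = ask-cong≡ nodeAt ρ a λ ρ' b _ _ → if-η (k ρ') b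
    where
    if-η : (f : Bool → Tree A) → ∀ b → (if b then f true else f false) ≡ f b
    if-η f true = refl
    if-η f false = refl
  run-fe (¬' P) ρ k = begin
    run ρ (replace A (fe A P) Ft Tt) k                           ≡⟨ run-replace ρ (fe A P) Ft Tt k ⟩
    run ρ (fe A P) (λ ρ' b → if b then k ρ' false else k ρ' true) ≡⟨ run-cong ρ (fe A P) (λ where _ true → refl; _ false → refl) ⟩
    run ρ (fe A P) (λ ρ' b → k ρ' (not b))                       ≡⟨ run-fe P ρ _ ⟩
    ⟦ ¬' P ⟧ ρ k                                                 ∎
    where open ≡-Reasoning
  run-fe (P ∧∙ Q) ρ k = begin
    run ρ (replace A (fe A P) (fe A Q) (replace A (fe A Q) Ft Ft)) k
      ≡⟨ run-replace ρ (fe A P) _ _ k ⟩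
    run ρ (fe A P) (λ ρ' b → if b then run ρ' (fe A Q) k else run ρ' (replace A (fe A Q) Ft Ft) k)
      ≡⟨ run-cong ρ (fe A P) second ⟩
    run ρ (fe A P) (λ ρ' b → ⟦ Q ⟧ ρ' λ ρ'' c → k ρ'' (b ∧ c))
      ≡⟨ run-fe P ρ _ ⟩
    ⟦ P ∧∙ Q ⟧ ρ k ∎
    where
    open ≡-Reasoning
    second : ∀ ρ' b → (if b then run ρ' (fe A Q) k else run ρ' (replace A (fe A Q) Ft Ft) k)
                      ≡ ⟦ Q ⟧ ρ' (λ ρ'' c → k ρ'' (b ∧ c))
    second ρ' true = run-fe Q ρ' k
    second ρ' false = ≡.trans (run-replace-same ρ' (fe A Q) Ft k) (run-fe Q ρ' _)
  run-fe (P ∨∙ Q) ρ k = begin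
    run ρ (replace A (fe A P) (replace A (fe A Q) Tt Tt) (fe A Q)) k
      ≡⟨ run-replace ρ (fe A P) _ _ k ⟩
    run ρ (fe A P) (λ ρ' b → if b then run ρ' (replace A (fe A Q) Tt Tt) k else run ρ' (fe A Q) k)
      ≡⟨ run-cong ρ (fe A P) second ⟩
    run ρ (fe A P) (λ ρ' b → ⟦ Q ⟧ ρ' λ ρ'' c → k ρ'' (b ∨ c))
      ≡⟨ run-fe P ρ _ ⟩
    ⟦ P ∨∙ Q ⟧ ρ k ∎
    where
    open ≡-Reasoning
    second : ∀ ρ' b → (if b then run ρ' (replace A (fe A Q) Tt Tt) k else run ρ' (fe A Q) k)
                      ≡ ⟦ Q ⟧ ρ' (λ ρ'' c → k ρ'' (b ∨ c))
    second ρ' true = ≡.trans (run-replace-same ρ' (fe A Q) Tt k) (run-fe Q ρ' _)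
    second ρ' false = run-fe Q ρ' k

  prune : PVal → Tree A → Tree A
  prune ρ Tt = Tt
  prune ρ Ft = Ft
  prune ρ (node l a r) =
    maybe′ (λ b → if b then prune ρ l else prune ρ r) (node (prune ρ l) a (prune ρ r)) (ρ a)

  prune-∅ : ∀ t → prune ∅ t ≡ t
  prune-∅ Tt = refl
  prune-∅ Ft = refl
  prune-∅ (node l a r) = cong₂ (nodeAt a) (prune-∅ l) (prune-∅ r)

  prune-known : ∀ {ρ a b} l r → ρ a ≡ just b → prune ρ (node l a r) ≡ (if b then prune ρ l else prune ρ r)
  prune-known l r e rewrite e = refl

  L-prune : ∀ {ρ a} t → ρ a ≡ nothing → L A _≟_ a (prune ρ t) ≡ prune (ρ [ a ≔ true ]) t
  L-prune Tt _ = refl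
  L-prune Ft _ = refl
  L-prune {ρ} {a} (node l c r) ρa≡nothing with ρ c in e
  ... | just true = ≡.trans (L-prune l ρa≡nothing) (≡.sym (prune-known l r (⊑-[≔] true ρa≡nothing c e)))
  ... | just false = ≡.trans (L-prune r ρa≡nothing) (≡.sym (prune-known l r (⊑-[≔] true ρa≡nothing c e)))
  ... | nothing with c ≟ a
  ...   | yes refl = L-prune l ρa≡nothing
  ...   | no _ rewrite e = cong₂ (nodeAt c) (L-prune l ρa≡nothing) (L-prune r ρa≡nothing)

  R-prune : ∀ {ρ a} t → ρ a ≡ nothing → R A _≟_ a (prune ρ t) ≡ prune (ρ [ a ≔ false ]) t
  R-prune Tt _ = refl
  R-prune Ft _ = refl
  R-prune {ρ} {a} (node l c r) ρa≡nothing with ρ c in e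
  ... | just true = ≡.trans (R-prune l ρa≡nothing) (≡.sym (prune-known l r (⊑-[≔] false ρa≡nothing c e)))
  ... | just false = ≡.trans (R-prune r ρa≡nothing) (≡.sym (prune-known l r (⊑-[≔] false ρa≡nothing c e)))
  ... | nothing with c ≟ a
  ...   | yes refl = R-prune r ρa≡nothing
  ...   | no _ rewrite e = cong₂ (nodeAt c) (R-prune l ρa≡nothing) (R-prune r ρa≡nothing)

  leaf : Bool → Tree A
  leaf b = if b then Tt else Ft

  leaves : Cont
  leaves _ = leaf

  size-left : ∀ l a r {n} → size A _≟_ (node l a r) ≤ suc n → size A _≟_ l ≤ n
  size-left l a r (s≤s h) = ≤-trans (m≤m+n (size A _≟_ l) (size A _≟_ r)) h

  size-right : ∀ l a r {n} → size A _≟_ (node l a r) ≤ suc n → size A _≟_ r ≤ n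
  size-right l a r (s≤s h) = ≤-trans (m≤n+m (size A _≟_ r) (size A _≟_ l)) h

  -- The recursion of m through L a and R a is pruning under a ↦ true and a ↦ false.
  m-fuel-prune : ∀ ρ t n → size A _≟_ t ≤ n → m-fuel A _≟_ n (prune ρ t) ≡ run ρ t leaves
  m-fuel-prune ρ Tt n _ = refl
  m-fuel-prune ρ Ft n _ = refl
  m-fuel-prune ρ (node l a r) (suc n) h with ρ a in e
  ... | just true = m-fuel-prune ρ l (suc n) (≤-trans (size-left l a r h) (n≤1+n n))
  ... | just false = m-fuel-prune ρ r (suc n) (≤-trans (size-right l a r h) (n≤1+n n))
  ... | nothing = cong₂ (nodeAt a)
    (≡.trans (cong (m-fuel A _≟_ n) (L-prune l e)) (m-fuel-prune _ l n (size-left l a r h)))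
    (≡.trans (cong (m-fuel A _≟_ n) (R-prune r e)) (m-fuel-prune _ r n (size-right l a r h)))

  m≡run : ∀ t → m A _≟_ t ≡ run ∅ t leaves
  m≡run t = begin
    m-fuel A _≟_ (size A _≟_ t) t            ≡⟨ cong (m-fuel A _≟_ _) (prune-∅ t) ⟨
    m-fuel A _≟_ (size A _≟_ t) (prune ∅ t)  ≡⟨ m-fuel-prune ∅ t _ ≤-refl ⟩
    run ∅ t leaves                           ∎
    where open ≡-Reasoning

  mfe≡⟦⟧ : ∀ P → mfe A _≟_ P ≡ ⟦ P ⟧ ∅ leaves
  mfe≡⟦⟧ P = ≡.trans (m≡run (fe A P)) (run-fe P ∅ leaves)

  -- Decision-tree form of the semantics

  atoms : SP A → List A
  atoms T = []
  atoms F = []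
  atoms (atom a) = a ∷ []
  atoms (¬' P) = atoms P
  atoms (P ∧∙ Q) = atoms P ++ atoms Q
  atoms (P ∨∙ Q) = atoms P ++ atoms Q

  val : SP A → PVal → Bool
  val T ρ = true
  val F ρ = false
  -- false is a junk value: val is only used where all atoms of the term are answered.
  val (atom a) ρ = fromMaybe false (ρ a)
  val (¬' P) ρ = not (val P ρ)
  val (P ∧∙ Q) ρ = val P ρ ∧ val Q ρ
  val (P ∨∙ Q) ρ = val P ρ ∨ val Q ρ

  val-stable : ∀ P {ρ ρ'} → All (Known ρ) (atoms P) → ρ ⊑ ρ' → val P ρ' ≡ val P ρ
  val-stable T _ _ = refl
  val-stable F _ _ = refl
  val-stable (atom a) ((b , e) ∷ []) ρ⊑ρ' = ≡.trans (cong (fromMaybe false) (ρ⊑ρ' a e)) (cong (fromMaybe false) (≡.sym e))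
  val-stable (¬' P) known ρ⊑ρ' = cong not (val-stable P known ρ⊑ρ')
  val-stable (P ∧∙ Q) known ρ⊑ρ' =
    cong₂ _∧_ (val-stable P (++⁻ˡ (atoms P) known) ρ⊑ρ') (val-stable Q (++⁻ʳ (atoms P) known) ρ⊑ρ')
  val-stable (P ∨∙ Q) known ρ⊑ρ' =
    cong₂ _∨_ (val-stable P (++⁻ˡ (atoms P) known) ρ⊑ρ') (val-stable Q (++⁻ʳ (atoms P) known) ρ⊑ρ')

  DecisionTree : SP A → Set
  DecisionTree P = ∀ ρ k → ⟦ P ⟧ ρ k ≡ decide nodeAt ρ (atoms P) (λ ρ' → k ρ' (val P ρ'))

  seqWith-decision : ∀ _⊕_ P Q → DecisionTree P → DecisionTree Q → ∀ ρ k →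
    seqWith _⊕_ ⟦ P ⟧ ⟦ Q ⟧ ρ k ≡ decide nodeAt ρ (atoms P ++ atoms Q) (λ ρ' → k ρ' (val P ρ' ⊕ val Q ρ'))
  seqWith-decision _⊕_ P Q dP dQ ρ k = begin
    ⟦ P ⟧ ρ (λ ρ₁ b → ⟦ Q ⟧ ρ₁ λ ρ₂ c → k ρ₂ (b ⊕ c))
      ≡⟨ dP ρ _ ⟩
    decide nodeAt ρ (atoms P) (λ ρ₁ → ⟦ Q ⟧ ρ₁ λ ρ₂ c → k ρ₂ (val P ρ₁ ⊕ c))
      ≡⟨ decide-cong≡ nodeAt ρ (atoms P) (λ ρ₁ _ knownP → ≡.trans (dQ ρ₁ _)
           (decide-cong≡ nodeAt ρ₁ (atoms Q) λ ρ₂ ρ₁⊑ρ₂ _ →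
             cong (λ v → k ρ₂ (v ⊕ val Q ρ₂)) (≡.sym (val-stable P knownP ρ₁⊑ρ₂)))) ⟩
    decide nodeAt ρ (atoms P) (λ ρ₁ → decide nodeAt ρ₁ (atoms Q) λ ρ₂ → k ρ₂ (val P ρ₂ ⊕ val Q ρ₂))
      ≡⟨ decide-++ nodeAt ρ (atoms P) (atoms Q) _ ⟨
    decide nodeAt ρ (atoms P ++ atoms Q) (λ ρ' → k ρ' (val P ρ' ⊕ val Q ρ'))
      ∎
    where open ≡-Reasoning

  decision-tree : ∀ P → DecisionTree P
  decision-tree T ρ k = refl
  decision-tree F ρ k = refl
  decision-tree (atom a) ρ k = ask-cong≡ nodeAt ρ a λ ρ' b _ e →
    cong (k ρ') (≡.sym (cong (fromMaybe false) e))
  decision-tree (¬' P) ρ k = decision-tree P ρ _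
  decision-tree (P ∧∙ Q) = seqWith-decision _∧_ P Q (decision-tree P) (decision-tree Q)
  decision-tree (P ∨∙ Q) = seqWith-decision _∨_ P Q (decision-tree P) (decision-tree Q)

  ⟦⟧-cong : ∀ P ρ {k k'} → (∀ ρ' → ρ ⊑ ρ' → All (Known ρ') (atoms P) → k ρ' (val P ρ') ≡ k' ρ' (val P ρ')) →
            ⟦ P ⟧ ρ k ≡ ⟦ P ⟧ ρ k'
  ⟦⟧-cong P ρ h = ≡.trans (decision-tree P ρ _)
    (≡.trans (decide-cong≡ nodeAt ρ (atoms P) h) (≡.sym (decision-tree P ρ _)))

  ⟦⟧-ext : ∀ P ρ {k k'} → (∀ ρ' b → k ρ' b ≡ k' ρ' b) → ⟦ P ⟧ ρ k ≡ ⟦ P ⟧ ρ k'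
  ⟦⟧-ext P ρ h = ⟦⟧-cong P ρ λ ρ' _ _ → h ρ' (val P ρ')

  ⟦⟧-known : ∀ P {ρ} k → All (Known ρ) (atoms P) → ⟦ P ⟧ ρ k ≡ k ρ (val P ρ)
  ⟦⟧-known P {ρ} k known = ≡.trans (decision-tree P ρ k) (decide-known nodeAt (atoms P) _ known)

  -- Soundness

  close : Term A → (ℕ → SP A) → SP A
  close (var n) η = η n
  close T η = T
  close F η = F
  close (atom a) η = atom a
  close (¬' t) η = ¬' (close t η)
  close (t ∧∙ u) η = close t η ∧∙ close u η
  close (t ∨∙ u) η = close t η ∨∙ close u η

  close-[] : ∀ t σ η → close (_[_] A t σ) η ≡ close t (λ n → close (σ n) η)
  close-[] (var n) σ η = refl
  close-[] T σ η = refl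
  close-[] F σ η = refl
  close-[] (atom a) σ η = refl
  close-[] (¬' t) σ η = cong ¬' (close-[] t σ η)
  close-[] (t ∧∙ u) σ η = cong₂ _∧∙_ (close-[] t σ η) (close-[] u σ η)
  close-[] (t ∨∙ u) σ η = cong₂ _∨∙_ (close-[] t σ η) (close-[] u σ η)

  close-⌈⌉ : ∀ P η → close ⌈ P ⌉ η ≡ P
  close-⌈⌉ T η = refl
  close-⌈⌉ F η = refl
  close-⌈⌉ (atom a) η = refl
  close-⌈⌉ (¬' P) η = cong ¬' (close-⌈⌉ P η)
  close-⌈⌉ (P ∧∙ Q) η = cong₂ _∧∙_ (close-⌈⌉ P η) (close-⌈⌉ Q η)
  close-⌈⌉ (P ∨∙ Q) η = cong₂ _∨∙_ (close-⌈⌉ P η) (close-⌈⌉ Q η)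

  infix 4 _≃_
  _≃_ : SP A → SP A → Set
  P ≃ Q = ∀ ρ k → ⟦ P ⟧ ρ k ≡ ⟦ Q ⟧ ρ k

  ⟦⟧-law₁ : (X : SP A) {f g : Bool → Bool} → (∀ b → f b ≡ g b) → ∀ ρ (k : Cont) →
          ⟦ X ⟧ ρ (λ ρ' b → k ρ' (f b)) ≡ ⟦ X ⟧ ρ (λ ρ' b → k ρ' (g b))
  ⟦⟧-law₁ X f≡g ρ k = ⟦⟧-ext X ρ λ ρ' b → cong (k ρ') (f≡g b)

  ⟦⟧-law₂ : (X Y : SP A) {f g : Bool → Bool → Bool} → (∀ b c → f b c ≡ g b c) → ∀ ρ (k : Cont) →
          ⟦ X ⟧ ρ (λ ρ₁ b → ⟦ Y ⟧ ρ₁ λ ρ₂ c → k ρ₂ (f b c)) ≡ ⟦ X ⟧ ρ (λ ρ₁ b → ⟦ Y ⟧ ρ₁ λ ρ₂ c → k ρ₂ (g b c))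
  ⟦⟧-law₂ X Y {f} {g} f≡g ρ k = ⟦⟧-ext X ρ λ ρ₁ b → ⟦⟧-law₁ Y {f b} {g b} (f≡g b) ρ₁ k

  ⟦⟧-law₃ : (X Y Z : SP A) {f g : Bool → Bool → Bool → Bool} → (∀ b c d → f b c d ≡ g b c d) → ∀ ρ (k : Cont) →
          ⟦ X ⟧ ρ (λ ρ₁ b → ⟦ Y ⟧ ρ₁ λ ρ₂ c → ⟦ Z ⟧ ρ₂ λ ρ₃ d → k ρ₃ (f b c d)) ≡
          ⟦ X ⟧ ρ (λ ρ₁ b → ⟦ Y ⟧ ρ₁ λ ρ₂ c → ⟦ Z ⟧ ρ₂ λ ρ₃ d → k ρ₃ (g b c d))
  ⟦⟧-law₃ X Y Z {f} {g} f≡g ρ k = ⟦⟧-ext X ρ λ ρ₁ b → ⟦⟧-law₂ Y Z {f b} {g b} (f≡g b) ρ₁ k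

  axiom-sound : ∀ {l r} → EqMFEL-axiom A l r → ∀ η → close l η ≃ close r η
  axiom-sound ax1 η ρ k = refl
  axiom-sound ax2 η = ⟦⟧-law₂ (η 0) (η 1) de-morgan
    where
    de-morgan : ∀ b c → b ∨ c ≡ not (not b ∧ not c)
    de-morgan true c = refl
    de-morgan false c = ≡.sym (Bool.not-involutive c)
  axiom-sound ax3 η = ⟦⟧-law₁ (η 0) Bool.not-involutive
  axiom-sound ax4 η = ⟦⟧-law₃ (η 0) (η 1) (η 2) Bool.∧-assoc
  axiom-sound ax5 η ρ k = refl
  axiom-sound ax6 η = ⟦⟧-law₁ (η 0) Bool.∧-identityʳ
  axiom-sound ax7 η = ⟦⟧-law₁ (η 0) Bool.∧-zeroʳ
  axiom-sound ax8 η = ⟦⟧-law₁ (η 0) λ b → ≡.trans (Bool.∧-zeroʳ (not b)) (≡.sym (Bool.∧-zeroʳ b))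
  axiom-sound ax9 η = ⟦⟧-law₂ (η 0) (η 1) λ b c →
    ≡.trans (cong (_∨ c) (Bool.∧-zeroʳ b)) (≡.sym (cong (_∧ c) (Bool.∨-zeroʳ b)))
  axiom-sound ax10 η = ⟦⟧-law₂ (η 0) (η 1) λ b c → begin
    b ∨ (c ∧ false)   ≡⟨ cong (b ∨_) (Bool.∧-zeroʳ c) ⟩
    b ∨ false         ≡⟨ Bool.∨-identityʳ b ⟩
    b                 ≡⟨ Bool.∧-identityʳ b ⟨
    b ∧ true          ≡⟨ cong (b ∧_) (Bool.∨-zeroʳ c) ⟨
    b ∧ (c ∨ true)    ∎
    where open ≡-Reasoning
  axiom-sound ax11 η ρ k =
    ⟦⟧-cong X ρ λ ρ₁ _ knownX → ⟦⟧-cong Y ρ₁ λ ρ₂ ρ₁⊑ρ₂ _ → ⟦⟧-cong Z ρ₂ λ ρ₃ ρ₂⊑ρ₃ knownZ →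
      ≡.sym (memo ρ₁ ρ₃ (⊑-trans ρ₁⊑ρ₂ ρ₂⊑ρ₃) knownX knownZ (val Y ρ₂))
    where
    X = η 0
    Y = η 1
    Z = η 2
    cases : ∀ b c d → (not b ∧ (c ∧ d)) ∨ (b ∧ d) ≡ (b ∨ c) ∧ d
    cases true c d = refl
    cases false c d = Bool.∨-identityʳ (c ∧ d)
    memo : ∀ ρ₁ ρ₃ → ρ₁ ⊑ ρ₃ → All (Known ρ₁) (atoms X) → All (Known ρ₃) (atoms Z) → ∀ c →
           ⟦ X ⟧ ρ₃ (λ ρ₄ b → ⟦ Z ⟧ ρ₄ λ ρ₅ d → k ρ₅ ((not (val X ρ₁) ∧ (c ∧ val Z ρ₃)) ∨ (b ∧ d)))
           ≡ k ρ₃ ((val X ρ₁ ∨ c) ∧ val Z ρ₃)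
    memo ρ₁ ρ₃ ρ₁⊑ρ₃ knownX knownZ c = begin
      ⟦ X ⟧ ρ₃ (λ ρ₄ b → ⟦ Z ⟧ ρ₄ λ ρ₅ d → k ρ₅ ((not bX ∧ (c ∧ dZ)) ∨ (b ∧ d)))
        ≡⟨ ⟦⟧-known X _ (All.map (⊑-Known ρ₁⊑ρ₃) knownX) ⟩
      ⟦ Z ⟧ ρ₃ (λ ρ₅ d → k ρ₅ ((not bX ∧ (c ∧ dZ)) ∨ (val X ρ₃ ∧ d)))
        ≡⟨ ⟦⟧-known Z _ knownZ ⟩
      k ρ₃ ((not bX ∧ (c ∧ dZ)) ∨ (val X ρ₃ ∧ dZ))
        ≡⟨ cong (λ b → k ρ₃ ((not bX ∧ (c ∧ dZ)) ∨ (b ∧ dZ))) (val-stable X knownX ρ₁⊑ρ₃) ⟩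
      k ρ₃ ((not bX ∧ (c ∧ dZ)) ∨ (bX ∧ dZ))
        ≡⟨ cong (k ρ₃) (cases bX c dZ) ⟩
      k ρ₃ ((bX ∨ c) ∧ dZ)
        ∎
      where
      open ≡-Reasoning
      bX = val X ρ₁
      dZ = val Z ρ₃

  derivable-sound : ∀ {t u} → t ≈ u → ∀ η → close t η ≃ close u η
  derivable-sound (axiom {l} {r} ax σ) η =
    ≡.subst₂ _≃_ (≡.sym (close-[] l σ η)) (≡.sym (close-[] r σ η)) (axiom-sound ax _)
  derivable-sound refl η ρ k = refl
  derivable-sound (sym t≈u) η ρ k = ≡.sym (derivable-sound t≈u η ρ k)
  derivable-sound (trans t≈u u≈v) η ρ k = ≡.trans (derivable-sound t≈u η ρ k) (derivable-sound u≈v η ρ k)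
  derivable-sound (cong¬ t≈u) η ρ k = derivable-sound t≈u η ρ _
  derivable-sound (cong∧ {t' = t'} t≈t' u≈u') η ρ k =
    ≡.trans (derivable-sound t≈t' η ρ _) (⟦⟧-ext (close t' η) ρ λ ρ' _ → derivable-sound u≈u' η ρ' _)
  derivable-sound (cong∨ {t' = t'} t≈t' u≈u') η ρ k =
    ≡.trans (derivable-sound t≈t' η ρ _) (⟦⟧-ext (close t' η) ρ λ ρ' _ → derivable-sound u≈u' η ρ' _)

  soundness : ∀ P Q → ⌈ P ⌉ ≈ ⌈ Q ⌉ → mfe A _≟_ P ≡ mfe A _≟_ Q
  soundness P Q P≈Q = begin
    mfe A _≟_ P                       ≡⟨ mfe≡⟦⟧ P ⟩
    ⟦ P ⟧ ∅ leaves                    ≡⟨ cong (λ P → ⟦ P ⟧ ∅ leaves) (close-⌈⌉ P η) ⟨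
    ⟦ close ⌈ P ⌉ η ⟧ ∅ leaves        ≡⟨ derivable-sound P≈Q η ∅ leaves ⟩
    ⟦ close ⌈ Q ⌉ η ⟧ ∅ leaves        ≡⟨ cong (λ Q → ⟦ Q ⟧ ∅ leaves) (close-⌈⌉ Q η) ⟩
    ⟦ Q ⟧ ∅ leaves                    ≡⟨ mfe≡⟦⟧ Q ⟨
    mfe A _≟_ Q                       ∎
    where
    open ≡-Reasoning
    -- Derivations may pass through open terms; any closing instance will do.
    η : ℕ → SP A
    η _ = T

  -- Completeness

  bool : Bool → SP A
  bool true = T
  bool false = F

  instantiate : PVal → SP A → SP A
  instantiate ρ T = T
  instantiate ρ F = F
  instantiate ρ (atom a) = maybe′ bool (atom a) (ρ a)
  instantiate ρ (¬' P) = ¬' (instantiate ρ P)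
  instantiate ρ (P ∧∙ Q) = instantiate ρ P ∧∙ instantiate ρ Q
  instantiate ρ (P ∨∙ Q) = instantiate ρ P ∨∙ instantiate ρ Q

  instantiate-∅ : ∀ P → instantiate ∅ P ≡ P
  instantiate-∅ T = refl
  instantiate-∅ F = refl
  instantiate-∅ (atom a) = refl
  instantiate-∅ (¬' P) = cong ¬' (instantiate-∅ P)
  instantiate-∅ (P ∧∙ Q) = cong₂ _∧∙_ (instantiate-∅ P) (instantiate-∅ Q)
  instantiate-∅ (P ∨∙ Q) = cong₂ _∨∙_ (instantiate-∅ P) (instantiate-∅ Q)

  instantiate-bool : ∀ ρ b → instantiate ρ (bool b) ≡ bool b
  instantiate-bool ρ true = refl
  instantiate-bool ρ false = refl

  instantiate-[≔] : ∀ {ρ a} b Q → ρ a ≡ nothing →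
                    instantiate (∅ [ a ≔ b ]) (instantiate ρ Q) ≡ instantiate (ρ [ a ≔ b ]) Q
  instantiate-[≔] b T _ = refl
  instantiate-[≔] b F _ = refl
  instantiate-[≔] {ρ} {a} b (atom c) ρa≡nothing with ρ c in e
  ... | just v = ≡.trans (instantiate-bool _ v) (cong (maybe′ bool (atom c)) (≡.sym (⊑-[≔] b ρa≡nothing c e)))
  ... | nothing with c ≟ a
  ...   | yes _ = refl
  ...   | no _ rewrite e = refl
  instantiate-[≔] b (¬' Q) ρa≡nothing = cong ¬' (instantiate-[≔] b Q ρa≡nothing)
  instantiate-[≔] b (P ∧∙ Q) ρa≡nothing = cong₂ _∧∙_ (instantiate-[≔] b P ρa≡nothing) (instantiate-[≔] b Q ρa≡nothing)
  instantiate-[≔] b (P ∨∙ Q) ρa≡nothing = cong₂ _∨∙_ (instantiate-[≔] b P ρa≡nothing) (instantiate-[≔] b Q ρa≡nothing)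

  literal : A → Bool → Term A
  literal a true = atom a
  literal a false = ¬' (atom a)

  literal-guards : ∀ a b → Guarded (literal a b) (atom a) (⌈ bool b ⌉)
                         × Guarded (literal a b) (¬' (atom a)) (¬' (⌈ bool b ⌉))
  literal-guards a true =
    (λ W → trans (∧-repeat (atom a) W) (cong∧ refl (sym (∧-identityʳ W)))) ,
    (λ W → trans (∧-repeat-¬ (atom a) W) (cong∧ refl (cong∧ refl F≈¬T)))
  literal-guards a false =
    (λ W → trans (cong∧ refl (cong∧ refl (sym (¬-involutive (atom a))))) (∧-repeat-¬ (¬' (atom a)) W)) ,
    (λ W → trans (∧-repeat (¬' (atom a)) W) (cong∧ refl (trans (sym (∧-identityʳ W)) (cong∧ refl (sym ¬F≈T)))))

  -- The negated component carries the induction through ¬ by De Morgan.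
  literal-assign : ∀ a b P → Guarded (literal a b) ⌈ P ⌉ (⌈ instantiate (∅ [ a ≔ b ]) P ⌉)
                           × Guarded (literal a b) (¬' ⌈ P ⌉) (¬' (⌈ instantiate (∅ [ a ≔ b ]) P ⌉))
  literal-assign a b T = (λ _ → refl) , (λ _ → refl)
  literal-assign a b F = (λ _ → refl) , (λ _ → refl)
  literal-assign a b (atom c) with c ≟ a
  ... | yes refl = literal-guards c b
  ... | no _ = (λ _ → refl) , (λ _ → refl)
  literal-assign a b (¬' P) =
    let (g , g¬) = literal-assign a b P in
    g¬ , Guarded-resp (¬-involutive _) (¬-involutive _) g
  literal-assign a b (P ∧∙ Q) =
    let (gP , gP¬) = literal-assign a b P ; (gQ , gQ¬) = literal-assign a b Q in
    Guarded-∧ gP gQ , Guarded-resp (¬-∧ _ _) (¬-∧ _ _) (Guarded-∨ gP¬ gQ¬)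
  literal-assign a b (P ∨∙ Q) =
    let (gP , gP¬) = literal-assign a b P ; (gQ , gQ¬) = literal-assign a b Q in
    Guarded-∨ gP gQ , Guarded-resp (¬-∨ _ _) (¬-∨ _ _) (Guarded-∧ gP¬ gQ¬)

  termBranch : A → Term A → Term A → Term A
  termBranch a l r = (literal a false ∧∙ r) ∨∙ (literal a true ∧∙ l)

  decide-cong≈ : ∀ ρ as {g g'} → (∀ ρ' → ρ ⊑ ρ' → All (Known ρ') as → g ρ' ≈ g' ρ') →
                 decide termBranch ρ as g ≈ decide termBranch ρ as g'
  decide-cong≈ = decide-cong termBranch _≈_ λ a l≈l' r≈r' → cong∨ (cong∧ refl r≈r') (cong∧ refl l≈l')

  bool-∨T : ∀ b → ⌈ bool b ⌉ ∨∙ T ≈ T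
  bool-∨T true = T∨T≈T
  bool-∨T false = ∨-identityˡ T

  Unfolds : SP A → Set
  Unfolds U = ∀ ρ Q → ⌈ instantiate ρ ((U ∨∙ T) ∧∙ Q) ⌉ ≈ decide termBranch ρ (atoms U) (λ ρ' → ⌈ instantiate ρ' Q ⌉)

  unfolds-seq : ∀ V W → Unfolds V → Unfolds W → ∀ ρ Q {x} →
                x ≈ (⌈ instantiate ρ V ⌉ ∨∙ T) ∧∙ (⌈ instantiate ρ W ⌉ ∨∙ T) →
                x ∧∙ ⌈ instantiate ρ Q ⌉ ≈ decide termBranch ρ (atoms V ++ atoms W) (λ ρ' → ⌈ instantiate ρ' Q ⌉)
  unfolds-seq V W uV uW ρ Q {x} x≈ = begin
    x ∧∙ ⌈ Q′ ρ ⌉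
      ≈⟨ cong∧ x≈ refl ⟩
    ((⌈ V′ ρ ⌉ ∨∙ T) ∧∙ (⌈ W′ ρ ⌉ ∨∙ T)) ∧∙ ⌈ Q′ ρ ⌉
      ≈⟨ ∧-assoc _ _ _ ⟩
    (⌈ V′ ρ ⌉ ∨∙ T) ∧∙ ((⌈ W′ ρ ⌉ ∨∙ T) ∧∙ ⌈ Q′ ρ ⌉)
      ≈⟨ uV ρ ((W ∨∙ T) ∧∙ Q) ⟩
    decide termBranch ρ (atoms V) (λ ρ' → (⌈ W′ ρ' ⌉ ∨∙ T) ∧∙ ⌈ Q′ ρ' ⌉)
      ≈⟨ decide-cong≈ ρ (atoms V) (λ ρ' _ _ → uW ρ' Q) ⟩
    decide termBranch ρ (atoms V) (λ ρ' → decide termBranch ρ' (atoms W) λ ρ'' → ⌈ Q′ ρ'' ⌉)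
      ≡⟨ decide-++ termBranch ρ (atoms V) (atoms W) _ ⟨
    decide termBranch ρ (atoms V ++ atoms W) (λ ρ' → ⌈ Q′ ρ' ⌉)
      ∎
    where
    open SetoidReasoning ≈-setoid
    V′ W′ Q′ : PVal → SP A
    V′ ρ = instantiate ρ V
    W′ ρ = instantiate ρ W
    Q′ ρ = instantiate ρ Q

  unfolds : ∀ U → Unfolds U
  unfolds T ρ Q = trans (cong∧ T∨T≈T refl) (∧-identityˡ _)
  unfolds F ρ Q = trans (cong∧ (∨-identityˡ T) refl) (∧-identityˡ _)
  unfolds (atom a) ρ Q with ρ a in e
  ... | just b = trans (cong∧ (bool-∨T b) refl) (∧-identityˡ _)
  ... | nothing = begin
    (atom a ∨∙ T) ∧∙ ⌈ instantiate ρ Q ⌉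
      ≈⟨ ∨-∧-casesᵀ (atom a) _ ⟩
    (¬' (atom a) ∧∙ ⌈ instantiate ρ Q ⌉) ∨∙ (atom a ∧∙ ⌈ instantiate ρ Q ⌉)
      ≈⟨ cong∨ (Guarded⇒∧ (proj₁ (literal-assign a false _))) (Guarded⇒∧ (proj₁ (literal-assign a true _))) ⟩
    (¬' (atom a) ∧∙ ⌈ instantiate (∅ [ a ≔ false ]) (instantiate ρ Q) ⌉) ∨∙
    (atom a ∧∙ ⌈ instantiate (∅ [ a ≔ true ]) (instantiate ρ Q) ⌉)
      ≡⟨ cong₂ (λ r l → (¬' (atom a) ∧∙ ⌈ r ⌉) ∨∙ (atom a ∧∙ ⌈ l ⌉))
               (instantiate-[≔] false Q e) (instantiate-[≔] true Q e) ⟩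
    (¬' (atom a) ∧∙ ⌈ instantiate (ρ [ a ≔ false ]) Q ⌉) ∨∙ (atom a ∧∙ ⌈ instantiate (ρ [ a ≔ true ]) Q ⌉)
      ∎
    where open SetoidReasoning ≈-setoid
  unfolds (¬' V) ρ Q = trans (cong∧ (¬-∨T _) refl) (unfolds V ρ Q)
  unfolds (V ∧∙ W) ρ Q = unfolds-seq V W (unfolds V) (unfolds W) ρ Q (∧-∨T _ _)
  unfolds (V ∨∙ W) ρ Q = unfolds-seq V W (unfolds V) (unfolds W) ρ Q (∨-∨T _ _)

  ¬-bool : ∀ b → ¬' ⌈ bool b ⌉ ≈ ⌈ bool (not b) ⌉
  ¬-bool true = sym F≈¬T
  ¬-bool false = ¬F≈T

  ∧-bool : ∀ b c → ⌈ bool b ⌉ ∧∙ ⌈ bool c ⌉ ≈ ⌈ bool (b ∧ c) ⌉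
  ∧-bool true c = ∧-identityˡ _
  ∧-bool false true = ∧-identityʳ F
  ∧-bool false false = F∧F≈F

  ∨-bool : ∀ b c → ⌈ bool b ⌉ ∨∙ ⌈ bool c ⌉ ≈ ⌈ bool (b ∨ c) ⌉
  ∨-bool true true = T∨T≈T
  ∨-bool true false = ∨-identityʳ T
  ∨-bool false c = ∨-identityˡ _

  instantiate-known : ∀ P {ρ} → All (Known ρ) (atoms P) → ⌈ instantiate ρ P ⌉ ≈ ⌈ bool (val P ρ) ⌉
  instantiate-known T _ = refl
  instantiate-known F _ = refl
  instantiate-known (atom a) ((b , e) ∷ []) rewrite e = refl
  instantiate-known (¬' P) known = trans (cong¬ (instantiate-known P known)) (¬-bool _)
  instantiate-known (P ∧∙ Q) known =
    trans (cong∧ (instantiate-known P (++⁻ˡ (atoms P) known)) (instantiate-known Q (++⁻ʳ (atoms P) known))) (∧-bool _ _)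
  instantiate-known (P ∨∙ Q) known =
    trans (cong∨ (instantiate-known P (++⁻ˡ (atoms P) known)) (instantiate-known Q (++⁻ʳ (atoms P) known))) (∨-bool _ _)

  NF : Tree A → Term A
  NF Tt = T
  NF Ft = F
  NF (node l a r) = termBranch a (NF l) (NF r)

  NF-leaf : ∀ b → NF (leaf b) ≡ ⌈ bool b ⌉
  NF-leaf true = refl
  NF-leaf false = refl

  ≈-NF-mfe : ∀ P → ⌈ P ⌉ ≈ NF (mfe A _≟_ P)
  ≈-NF-mfe P = begin
    ⌈ P ⌉
      ≈⟨ ∨T-∧-absorb ⌈ P ⌉ ⟨
    ⌈ (P ∨∙ T) ∧∙ P ⌉
      ≡⟨ cong ⌈_⌉ (instantiate-∅ ((P ∨∙ T) ∧∙ P)) ⟨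
    ⌈ instantiate ∅ ((P ∨∙ T) ∧∙ P) ⌉
      ≈⟨ unfolds P ∅ P ⟩
    decide termBranch ∅ (atoms P) (λ ρ → ⌈ instantiate ρ P ⌉)
      ≈⟨ decide-cong≈ ∅ (atoms P) (λ ρ _ known → instantiate-known P known) ⟩
    decide termBranch ∅ (atoms P) (λ ρ → ⌈ bool (val P ρ) ⌉)
      ≡⟨ decide-cong≡ termBranch ∅ (atoms P) (λ ρ _ _ → NF-leaf (val P ρ)) ⟨
    decide termBranch ∅ (atoms P) (λ ρ → NF (leaf (val P ρ)))
      ≡⟨ decide-map NF (λ _ _ _ → refl) ∅ (atoms P) _ ⟨
    NF (decide nodeAt ∅ (atoms P) (λ ρ → leaf (val P ρ)))
      ≡⟨ cong NF (decision-tree P ∅ leaves) ⟨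
    NF (⟦ P ⟧ ∅ leaves)
      ≡⟨ cong NF (mfe≡⟦⟧ P) ⟨
    NF (mfe A _≟_ P)
      ∎
    where open SetoidReasoning ≈-setoid

  completeness : ∀ P Q → mfe A _≟_ P ≡ mfe A _≟_ Q → ⌈ P ⌉ ≈ ⌈ Q ⌉
  completeness P Q mfe≡ = trans (≈-NF-mfe P) (trans (reflexive (cong NF mfe≡)) (sym (≈-NF-mfe Q)))
    where open Setoid ≈-setoid using (reflexive)

theorem4p18 : (A : Set) → Countable A → (_≟_ : DecidableEquality A) →
    (P Q : SP A) →
    (EqMFEL⊢_≈_ A (⌜_⌝ A P) (⌜_⌝ A Q)) ⇔ (mfe A _≟_ P ≡ mfe A _≟_ Q)
theorem4p18 A _ _≟_ P Q = mk⇔ (soundness A _≟_ P Q) (completeness A _≟_ P Q)
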